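{- Let $S=(V,E,\sigma)$ be a signed graph, $k,r\in\mathbb{N}$, and $w_1,\dots,w_k:V\to\mathbb{Z}$ weight functions. Let $G=(V,E)$ and $R=\{v\in V: \exists i\in[k]: w_i(v)\ne 0\}$. If $G$ has an $r$-decorated tree (with respect to $R$) as a subgraph, then there is some $i\in[k]$ such that $\mathrm{alt}(S,w_i)\ge\frac{r}{2k}$.
   Context: A signed graph is a triple $S=(V,E,\sigma)$ where $(V,E)$ is a graph and $\sigma:E\to\{ -1,+1\}$; an edge $e$ is odd if $\sigma(e)=-1$ and even otherwise. For a subgraph $T$ of $S$ that is a tree, let $A_T,B_T$ be the partition of $V(T)$ such that every even edge of $T$ has both endpoints in the same part and every odd edge has endpoints in different parts. For $w:V\to\mathbb{Z}$, $\mathrm{alt}(T,w)=\left|\sum_{v\in A_T}w(v)-\sum_{v\in B_T}w(v)\right|$ and $\mathrm{alt}(S,w)$ is the maximum of $\mathrm{alt}(T,w)$ over all subgraphs $T$ of $S$ that are trees. Given a set of terminals $R\subseteq V$, a graph is $r$-decorated if it is a tree and at least $r$ of its leaves are in $R$. $[k]=\{1,\dots,k\}$. -}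

module Defs where

open import Data.Nat using (ℕ; zero; suc; _+_; _*_; _≤_)
open import Data.Fin using (Fin; zero; suc; fromℕ; inject₁)
open import Data.Integer as ℤ using (ℤ; 0ℤ)
open import Data.Bool using (Bool; true; false; if_then_else_)
open import Data.Product using (Σ; ∃; _×_; _,_; proj₁; proj₂)
open import Data.Sum using (_⊎_)
open import Relation.Binary.PropositionalEquality using (_≡_; _≢_)
open import Relation.Nullary using (¬_)
open import Function.Definitions using (Injective)
open import Data.Fin.Properties using () renaming (_≟_ to _≟ᶠ_)
open import Relation.Nullary.Decidable using (⌊_⌋)

-- Signs of edges: odd edges have σ(e) = -1, even edges have σ(e) = +1.
data Sign : Set where
  even odd : Sign

record SignedGraph (n : ℕ) : Set where
  field
    m    : ℕ
    ends : Fin m → Fin n × Fin n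
    σ    : Fin m → Sign
open SignedGraph public

module _ {n : ℕ} (S : SignedGraph n) where

  Joins : Fin (m S) → Fin n → Fin n → Set
  Joins e x y = ends S e ≡ (x , y) ⊎ ends S e ≡ (y , x)

  record Subgraph : Set where
    field
      U : Fin n → Bool
      F : Fin (m S) → Bool
      closed : ∀ e → F e ≡ true →
               U (proj₁ (ends S e)) ≡ true × U (proj₂ (ends S e)) ≡ true
  open Subgraph public

  data Walk (T : Subgraph) : Fin n → Fin n → Set where
    nil  : ∀ {x} → U T x ≡ true → Walk T x x
    step : ∀ {x y z} (e : Fin (m S)) → F T e ≡ true → Joins e x y →
           Walk T y z → Walk T x z

  Connected : Subgraph → Set
  Connected T = ∀ x y → U T x ≡ true → U T y ≡ true → Walk T x y

  record Cycle (T : Subgraph) : Set where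
    field
      len   : ℕ
      vs    : Fin (suc (suc len)) → Fin n
      es    : Fin (suc len) → Fin (m S)
      close : vs (fromℕ (suc len)) ≡ vs zero
      vinj  : Injective _≡_ _≡_ (λ i → vs (inject₁ i))
      einj  : Injective _≡_ _≡_ es
      inF   : ∀ i → F T (es i) ≡ true
      join  : ∀ i → Joins (es i) (vs (inject₁ i)) (vs (suc i))

  IsTree : Subgraph → Set
  IsTree T = (∃ λ x → U T x ≡ true) × Connected T × ¬ Cycle T

  sumℕ : ∀ {j} → (Fin j → ℕ) → ℕ
  sumℕ {zero}  f = 0
  sumℕ {suc j} f = f zero + sumℕ (λ i → f (suc i))

  sumℤ : ∀ {j} → (Fin j → ℤ) → ℤ
  sumℤ {zero}  f = 0ℤ
  sumℤ {suc j} f = f zero ℤ.+ sumℤ (λ i → f (suc i))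

  -- degree of x in T (loops count twice)
  degree : Subgraph → Fin n → ℕ
  degree T x = sumℕ (λ e → if F T e
      then ((if ⌊ proj₁ (ends S e) ≟ᶠ x ⌋ then 1 else 0)
            + (if ⌊ proj₂ (ends S e) ≟ᶠ x ⌋ then 1 else 0))
      else 0)

  IsLeaf : Subgraph → Fin n → Set
  IsLeaf T x = U T x ≡ true × degree T x ≡ 1

  Decorated : (R : Fin n → Set) → ℕ → Subgraph → Set
  Decorated R r T = IsTree T ×
    Σ (Fin r → Fin n) λ f → Injective _≡_ _≡_ f × (∀ j → IsLeaf T (f j) × R (f j))

  -- A valid partition (A_T , B_T) of V(T), encoded by side : true ↦ A_T,
  -- false ↦ B_T: even edges inside a part, odd edges across.
  ValidPartition : Subgraph → (Fin n → Bool) → Set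
  ValidPartition T side = ∀ e → F T e ≡ true →
    (σ S e ≡ even → side (proj₁ (ends S e)) ≡ side (proj₂ (ends S e))) ×
    (σ S e ≡ odd  → side (proj₁ (ends S e)) ≢ side (proj₂ (ends S e)))

  altWith : Subgraph → (Fin n → Bool) → (Fin n → ℤ) → ℕ
  altWith T side w = ℤ.∣ sumℤ (λ v → if U T v
      then (if side v then w v else ℤ.- w v) else 0ℤ) ∣

  -- alt(S, w) ≥ q  (as a rational q = a / b with b > 0):  b · alt(S,w) ≥ a,
  -- i.e. some tree subgraph T of S has b · alt(T,w) ≥ a.
  AltAtLeast : (w : Fin n → ℤ) (a b : ℕ) → Set
  AltAtLeast w a b = Σ Subgraph λ T → IsTree T ×
    Σ (Fin n → Bool) λ side → ValidPartition T side × a ≤ b * altWith T side w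

-- Colour the decorated tree T by the parity of the odd edges on walks from a root: since T
-- is acyclic this parity does not depend on the walk, so it is a valid partition of T and of
-- every subtree of T.  For one weight w, remove from T the decorated leaves whose signed
-- weight is negative, or alternatively those whose signed weight is nonnegative.  Both
-- leave a tree (or nothing), and the two signed sums differ by exactly the leaf weight
-- D = Σ ∣ w ∣ over the decorated leaves, so one of them has absolute value at least D / 2.
-- Every decorated leaf is a terminal, so summing D over the k weights gives at least r,
-- and the largest D is at least r / k.

module Submission where

open import Defs
open import Data.Nat as ℕ using (ℕ; zero; suc; _+_; _≤_; _*_; z≤n; s≤s)
import Data.Nat.Properties as ℕP
open import Data.Integer as ℤ using (ℤ; 0ℤ; +_; -[1+_]; ∣_∣)
import Data.Integer.Properties as ℤP
open import Data.Fin using (Fin; zero; suc; fromℕ; inject₁)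
open import Data.Fin.Properties using (any?; suc-injective; inject₁-injective; fromℕ≢inject₁) renaming (_≟_ to _≟ᶠ_)
open import Data.Bool using (Bool; true; false; not; _∧_; _xor_; if_then_else_)
open import Data.Bool.Properties using (xor-assoc; xor-comm; xor-identityʳ; xor-same; true-xor; not-¬; not-injective; ¬-not; ∧-identityʳ) renaming (_≟_ to _≟ᵇ_)
open import Data.Product using (Σ; ∃; _×_; _,_; proj₁; proj₂; swap)
open import Data.Sum using (_⊎_; inj₁; inj₂; [_,_]′)
open import Data.Unit using (⊤; tt)
open import Data.Empty using (⊥-elim)
open import Function using (_∘_)
open import Function.Definitions using (Injective)
open import Relation.Binary.PropositionalEquality
open import Relation.Nullary using (¬_; does; yes; no; contradiction)
open import Relation.Nullary.Decidable using (⌊_⌋; isYes≗does; dec-true)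
import Algebra.Properties.CommutativeMonoid.Sum as CommutativeMonoidSum
open import Data.Integer.Solver using (module +-*-Solver)
open +-*-Solver using (solve; _:+_; _:-_; _:=_)

xor≡false⇒≡ : ∀ {a b} → a xor b ≡ false → a ≡ b
xor≡false⇒≡ {false} {false} _ = refl
xor≡false⇒≡ {true}  {true}  _ = refl

∧-true⁻ : ∀ {a b} → a ∧ b ≡ true → a ≡ true × b ≡ true
∧-true⁻ {true} {true} _ = refl , refl

∧-true⁺ : ∀ {a b} → a ≡ true → b ≡ true → a ∧ b ≡ true
∧-true⁺ refl refl = refl

m≤n+o⇒m≤2n⊎m≤2o : ∀ {m} n o → m ≤ n + o → m ≤ 2 * n ⊎ m ≤ 2 * o
m≤n+o⇒m≤2n⊎m≤2o n o m≤n+o with ℕP.≤-total n o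
... | inj₁ n≤o = inj₂ (ℕP.≤-trans m≤n+o (ℕP.+-mono-≤ n≤o (ℕP.≤-reflexive (sym (ℕP.+-identityʳ o)))))
... | inj₂ o≤n = inj₁ (ℕP.≤-trans m≤n+o (ℕP.+-monoʳ-≤ n (ℕP.≤-trans o≤n (ℕP.≤-reflexive (sym (ℕP.+-identityʳ n))))))

isNegative : ℤ → Bool
isNegative (+ _)    = false
isNegative -[1+ _ ] = true

-- One vertex's term in the two pruned sums of the header: u says whether it lies in the tree,
-- i whether it is a decorated leaf, and z is its signed weight.
sign-split : ∀ u i z → (i ≡ true → u ≡ true) →
  (if u ∧ not (i ∧ isNegative z) then z else 0ℤ) ≡
  (if u ∧ not (i ∧ not (isNegative z)) then z else 0ℤ) ℤ.+ + (if i then ∣ z ∣ else 0)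
sign-split u false z _ rewrite ∧-identityʳ u = sym (ℤP.+-identityʳ _)
sign-split u true  z i⇒u rewrite i⇒u refl with z
... | + _      = refl
... | -[1+ k ] = sym (ℤP.n⊖n≡0 (suc k))

-- Finite sums

module ℕΣ = CommutativeMonoidSum ℕP.+-0-commutativeMonoid
module ℤΣ = CommutativeMonoidSum ℤP.+-0-commutativeMonoid
open ℕΣ using (sum)

term≤sum : ∀ {j} (g : Fin j → ℕ) i → g i ≤ sum g
term≤sum g zero    = ℕP.m≤m+n (g zero) _
term≤sum g (suc i) = ℕP.≤-trans (term≤sum (g ∘ suc) i) (ℕP.m≤n+m _ (g zero))

size≤sum : ∀ {j} (g : Fin j → ℕ) → (∀ i → 1 ≤ g i) → j ≤ sum g
size≤sum {zero}  g 1≤g = z≤n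
size≤sum {suc j} g 1≤g = ℕP.+-mono-≤ (1≤g zero) (size≤sum (g ∘ suc) (1≤g ∘ suc))

sum≤size*max : ∀ {k} (g : Fin (suc k) → ℕ) → ∃ λ i → sum g ≤ suc k * g i
sum≤size*max {zero}  g = zero , ℕP.≤-refl
sum≤size*max {suc k} g with sum≤size*max (g ∘ suc)
... | i , ∑≤ with g zero ℕP.≤? g (suc i)
...   | yes g₀≤gᵢ = suc i , ℕP.+-mono-≤ g₀≤gᵢ ∑≤
...   | no  g₀≰gᵢ = zero , ℕP.+-monoʳ-≤ (g zero)
                      (ℕP.≤-trans ∑≤ (ℕP.*-monoʳ-≤ (suc k) (ℕP.<⇒≤ (ℕP.≰⇒> g₀≰gᵢ))))

sum≡1⇒support-unique : ∀ {j} (g : Fin j → ℕ) {a b} →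
                       sum g ≡ 1 → 1 ≤ g a → 1 ≤ g b → a ≡ b
sum≡1⇒support-unique g {zero}  {zero}  _ _ _ = refl
sum≡1⇒support-unique g {zero}  {suc b} ∑≡1 ga gb =
  contradiction ∑≡1 (ℕP.>⇒≢ (ℕP.+-mono-≤ ga (ℕP.≤-trans gb (term≤sum (g ∘ suc) b))))
sum≡1⇒support-unique g {suc a} {zero}  ∑≡1 ga gb =
  contradiction ∑≡1 (ℕP.>⇒≢ (ℕP.+-mono-≤ gb (ℕP.≤-trans ga (term≤sum (g ∘ suc) a))))
sum≡1⇒support-unique g {suc a} {suc b} ∑≡1 ga gb with g zero
... | zero  = cong suc (sum≡1⇒support-unique (g ∘ suc) ∑≡1 ga gb)
... | suc _ = contradiction ∑≡1
                (ℕP.>⇒≢ (s≤s (ℕP.≤-trans ga (ℕP.≤-trans (term≤sum (g ∘ suc) a) (ℕP.m≤n+m _ _)))))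

sum-point : ∀ {n} (a : Fin n) (g : Fin n → ℕ) →
            sum (λ v → if does (a ≟ᶠ v) then g v else 0) ≡ g a
sum-point {suc n} zero g = trans (cong (λ s → g zero + s) (ℕΣ.sum-replicate-zero n)) (ℕP.+-identityʳ _)
sum-point (suc a) g = sum-point a (g ∘ suc)

-- Defined with does rather than ⌊_⌋ so that it unfolds definitionally along f zero and f ∘ suc.
image? : ∀ {r n} → (Fin r → Fin n) → Fin n → Bool
image? f v = does (any? (λ j → f j ≟ᶠ v))

sum-image : ∀ {r n} (f : Fin r → Fin n) → Injective _≡_ _≡_ f → (g : Fin n → ℕ) →
            sum (λ v → if image? f v then g v else 0) ≡ sum (g ∘ f)
sum-image {zero} {n} f _ g = ℕΣ.sum-replicate-zero n
sum-image {suc r} f f-inj g = begin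
  sum (λ v → if image? f v then g v else 0)  ≡⟨ ℕΣ.sum-cong-≗ split ⟩
  sum (λ v → at-f₀ v + in-rest v)            ≡⟨ ℕΣ.∑-distrib-+ at-f₀ in-rest ⟩
  sum at-f₀ + sum in-rest                    ≡⟨ cong₂ _+_ (sum-point (f zero) g) (sum-image (f ∘ suc) (suc-injective ∘ f-inj) g) ⟩
  g (f zero) + sum (g ∘ f ∘ suc)             ∎
  where
  open ≡-Reasoning
  at-f₀ in-rest : Fin _ → ℕ
  at-f₀   v = if does (f zero ≟ᶠ v) then g v else 0
  in-rest v = if image? (f ∘ suc) v then g v else 0

  split : ∀ v → (if image? f v then g v else 0) ≡ at-f₀ v + in-rest v
  split v with f zero ≟ᶠ v | any? (λ j → f (suc j) ≟ᶠ v)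
  ... | yes refl | yes (j , fⱼ≡f₀) = contradiction (f-inj fⱼ≡f₀) λ ()
  ... | yes refl | no _ = sym (ℕP.+-identityʳ _)
  ... | no _     | _    = refl

sum-pos : ∀ {j} (g : Fin j → ℕ) → ℤΣ.sum (λ i → + g i) ≡ + sum g
sum-pos {zero}  g = refl
sum-pos {suc j} g = trans (cong (λ s → + g zero ℤ.+ s) (sum-pos (g ∘ suc))) (sym (ℤP.pos-+ (g zero) (sum (g ∘ suc))))

module _ {n} (S : SignedGraph n) where

  sumℕ≡sum : ∀ {j} (g : Fin j → ℕ) → sumℕ S g ≡ sum g
  sumℕ≡sum {zero}  g = refl
  sumℕ≡sum {suc j} g = cong (λ s → g zero + s) (sumℕ≡sum (g ∘ suc))

  sumℤ≡sum : ∀ {j} (g : Fin j → ℤ) → sumℤ S g ≡ ℤΣ.sum g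
  sumℤ≡sum {zero}  g = refl
  sumℤ≡sum {suc j} g = cong (λ s → g zero ℤ.+ s) (sumℤ≡sum (g ∘ suc))

  Joins-sym : ∀ {e x y} → Joins S e x y → Joins S e y x
  Joins-sym (inj₁ p) = inj₂ p
  Joins-sym (inj₂ p) = inj₁ p

  Joins-endpoints : ∀ {e x y x′ y′} → Joins S e x y → Joins S e x′ y′ →
                    (x ≡ x′ × y ≡ y′) ⊎ (x ≡ y′ × y ≡ x′)
  Joins-endpoints (inj₁ refl) (inj₁ refl) = inj₁ (refl , refl)
  Joins-endpoints (inj₁ refl) (inj₂ refl) = inj₂ (refl , refl)
  Joins-endpoints (inj₂ refl) (inj₁ refl) = inj₂ (refl , refl)
  Joins-endpoints (inj₂ refl) (inj₂ refl) = inj₁ (refl , refl)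

  Cycle-mono : ∀ {T T′ : Subgraph S} → (∀ e → F T′ e ≡ true → F T e ≡ true) →
               Cycle S T′ → Cycle S T
  Cycle-mono F′⊆F C = record
    { len = len ; vs = vs ; es = es ; close = close ; vinj = vinj ; einj = einj
    ; inF = λ i → F′⊆F (es i) (inF i) ; join = join }
    where open Cycle C

  ValidPartition-mono : ∀ {T T′ : Subgraph S} {side} → (∀ e → F T′ e ≡ true → F T e ≡ true) →
                        ValidPartition S T side → ValidPartition S T′ side
  ValidPartition-mono F′⊆F valid e e∈T′ = valid e (F′⊆F e e∈T′)

  odd? : Sign → Bool
  odd? even = false
  odd? odd  = true

  -- Walks and the parity of their odd edges

  module Walks (T : Subgraph S) where

    Joins⇒∈U : ∀ {e x y} → F T e ≡ true → Joins S e x y → U T x ≡ true × U T y ≡ true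
    Joins⇒∈U {e} e∈T (inj₁ refl) = closed T e e∈T
    Joins⇒∈U {e} e∈T (inj₂ refl) = swap (closed T e e∈T)

    start∈U : ∀ {x y} → Walk S T x y → U T x ≡ true
    start∈U (nil x∈T)          = x∈T
    start∈U (step _ e∈T j _)   = proj₁ (Joins⇒∈U e∈T j)

    end∈U : ∀ {x y} → Walk S T x y → U T y ≡ true
    end∈U (nil y∈T)      = y∈T
    end∈U (step _ _ _ w) = end∈U w

    length : ∀ {x y} → Walk S T x y → ℕ
    length (nil _)        = zero
    length (step _ _ _ w) = suc (length w)

    vertex : ∀ {x y} (W : Walk S T x y) → Fin (suc (length W)) → Fin n
    vertex {x} _ zero               = x
    vertex (step _ _ _ w) (suc i)   = vertex w i

    edge : ∀ {x y} (W : Walk S T x y) → Fin (length W) → Fin (m S)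
    edge (step e _ _ _) zero    = e
    edge (step _ _ _ w) (suc i) = edge w i

    vertex-last : ∀ {x y} (W : Walk S T x y) → vertex W (fromℕ (length W)) ≡ y
    vertex-last (nil _)        = refl
    vertex-last (step _ _ _ w) = vertex-last w

    edge-joins : ∀ {x y} (W : Walk S T x y) i →
                 Joins S (edge W i) (vertex W (inject₁ i)) (vertex W (suc i))
    edge-joins (step _ _ j _) zero    = j
    edge-joins (step _ _ _ w) (suc i) = edge-joins w i

    edge∈T : ∀ {x y} (W : Walk S T x y) i → F T (edge W i) ≡ true
    edge∈T (step _ e∈T _ _) zero    = e∈T
    edge∈T (step _ _ _ w)   (suc i) = edge∈T w i

    parity : ∀ {x y} → Walk S T x y → Bool
    parity (nil _)        = false
    parity (step e _ _ w) = odd? (σ S e) xor parity w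

    _++_ : ∀ {x y z} → Walk S T x y → Walk S T y z → Walk S T x z
    nil _          ++ w′ = w′
    step e p j w   ++ w′ = step e p j (w ++ w′)

    parity-++ : ∀ {x y z} (w : Walk S T x y) (w′ : Walk S T y z) →
                parity (w ++ w′) ≡ parity w xor parity w′
    parity-++ (nil _)        w′ = refl
    parity-++ (step e _ _ w) w′ =
      trans (cong (odd? (σ S e) xor_) (parity-++ w w′)) (sym (xor-assoc (odd? (σ S e)) _ _))

    reverse : ∀ {x y} → Walk S T x y → Walk S T y x
    reverse (nil x∈T)        = nil x∈T
    reverse (step e e∈T j w) = reverse w ++ step e e∈T (Joins-sym j) (nil (start∈U (step e e∈T j w)))

    parity-reverse : ∀ {x y} (w : Walk S T x y) → parity (reverse w) ≡ parity w
    parity-reverse (nil _)          = refl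
    parity-reverse (step e e∈T j w) = begin
      parity (reverse w ++ _)                  ≡⟨ parity-++ (reverse w) _ ⟩
      parity (reverse w) xor (odd? (σ S e) xor false) ≡⟨ cong₂ _xor_ (parity-reverse w) (xor-identityʳ _) ⟩
      parity w xor odd? (σ S e)                ≡⟨ xor-comm (parity w) _ ⟩
      odd? (σ S e) xor parity w                ∎
      where open ≡-Reasoning

    IsPath : ∀ {x y} → Walk S T x y → Set
    IsPath (nil _)            = ⊤
    IsPath {x} (step _ _ _ w) = (∀ i → vertex w i ≢ x) × IsPath w

    vertex-injective : ∀ {x y} (P : Walk S T x y) → IsPath P → Injective _≡_ _≡_ (vertex P)
    vertex-injective _              _            {zero}  {zero}  _  = refl
    vertex-injective (step _ _ _ w) (x∉w , _)    {zero}  {suc j} eq = contradiction (sym eq) (x∉w j)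
    vertex-injective (step _ _ _ w) (x∉w , _)    {suc i} {zero}  eq = contradiction eq (x∉w i)
    vertex-injective (step _ _ _ w) (_ , w-path) {suc i} {suc j} eq =
      cong suc (vertex-injective w w-path eq)

    edge-fresh : ∀ {e x y z} (j : Joins S e x y) (w : Walk S T y z) →
                 (∀ i → vertex w i ≢ x) → ∀ k → e ≢ edge w k
    edge-fresh j w x∉w k refl =
      [ x∉w (inject₁ k) ∘ sym ∘ proj₁ , x∉w (suc k) ∘ sym ∘ proj₁ ]′ (Joins-endpoints j (edge-joins w k))

    edge-injective : ∀ {x y} (P : Walk S T x y) → IsPath P → Injective _≡_ _≡_ (edge P)
    edge-injective (step _ _ _ _) _            {zero}  {zero}  _  = refl
    edge-injective (step _ _ j w) (x∉w , _)    {zero}  {suc k} eq = contradiction eq (edge-fresh j w x∉w k)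
    edge-injective (step _ _ j w) (x∉w , _)    {suc i} {zero}  eq = contradiction (sym eq) (edge-fresh j w x∉w i)
    edge-injective (step _ _ _ w) (_ , w-path) {suc i} {suc j} eq =
      cong suc (edge-injective w w-path eq)

    take : ∀ {x y} (W : Walk S T x y) i → Walk S T x (vertex W i)
    take W              zero    = nil (start∈U W)
    take (step e p j w) (suc i) = step e p j (take w i)

    drop : ∀ {x y} (W : Walk S T x y) i → Walk S T (vertex W i) y
    drop W              zero    = W
    drop (step _ _ _ w) (suc i) = drop w i

    take++drop : ∀ {x y} (W : Walk S T x y) i → take W i ++ drop W i ≡ W
    take++drop W              zero    = refl
    take++drop (step e p j w) (suc i) = cong (step e p j) (take++drop w i)

    vertex-take : ∀ {x y} (W : Walk S T x y) i k → ∃ λ k′ → vertex (take W i) k ≡ vertex W k′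
    vertex-take W              zero    zero    = zero , refl
    vertex-take (step _ _ _ w) (suc i) zero    = zero , refl
    vertex-take (step _ _ _ w) (suc i) (suc k) = let k′ , eq = vertex-take w i k in suc k′ , eq

    take-isPath : ∀ {x y} (P : Walk S T x y) i → IsPath P → IsPath (take P i)
    take-isPath P              zero    _              = tt
    take-isPath (step _ _ _ w) (suc i) (x∉w , w-path) =
      (λ k eq → let k′ , eq′ = vertex-take w i k in x∉w k′ (trans (sym eq′) eq)) ,
      take-isPath w i w-path

    drop-isPath : ∀ {x y} (P : Walk S T x y) i → IsPath P → IsPath (drop P i)
    drop-isPath P              zero    P-path      = P-path
    drop-isPath (step _ _ _ w) (suc i) (_ , w-path) = drop-isPath w i w-path

    single-edge-parity : ∀ {x y} (P : Walk S T x y) k → inject₁ k ≡ zero → suc k ≡ fromℕ (length P) →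
                         parity P ≡ odd? (σ S (edge P k))
    single-edge-parity (step _ _ _ (nil _))        zero    _  _  = xor-identityʳ _
    single-edge-parity (step _ _ _ (step _ _ _ _)) zero    _  ()
    single-edge-parity (step _ _ _ (step _ _ _ _)) (suc _) () _

    odd-closed-path⇒cycle : ∀ {x y e} (e∈T : F T e ≡ true) (j : Joins S e x y) (P : Walk S T y x) →
                            IsPath P → parity (step e e∈T j P) ≡ true → Cycle S T
    odd-closed-path⇒cycle {x} {e = e} e∈T j P P-path odd-loop = record
      { len = length P ; vs = vertex C ; es = edge C ; close = vertex-last P
      ; vinj = vinj ; einj = einj ; inF = edge∈T C ; join = edge-joins C }
      where
      C : Walk S T x x
      C = step e e∈T j P

      P-inj : Injective _≡_ _≡_ (vertex P)
      P-inj = vertex-injective P P-path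

      x∉P : ∀ i → vertex P (inject₁ i) ≢ x
      x∉P i eq = fromℕ≢inject₁ {i = i} (P-inj (trans (vertex-last P) (sym eq)))

      vinj : Injective _≡_ _≡_ (λ i → vertex C (inject₁ i))
      vinj {zero}  {zero}  _  = refl
      vinj {zero}  {suc j} eq = contradiction (sym eq) (x∉P j)
      vinj {suc i} {zero}  eq = contradiction eq (x∉P i)
      vinj {suc i} {suc j} eq = cong suc (inject₁-injective (P-inj eq))

      -- Otherwise P would be the single edge e traversed backwards, and the loop would be even.
      e∉P : ∀ k → e ≢ edge P k
      e∉P k e≡eₖ with Joins-endpoints j (subst (λ e′ → Joins S e′ _ _) (sym e≡eₖ) (edge-joins P k))
      ... | inj₁ (x≡ , _)  = x∉P k (sym x≡)
      ... | inj₂ (x≡ , y≡) = contradiction (begin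
        true                                ≡⟨ odd-loop ⟨
        odd? (σ S e) xor parity P           ≡⟨ cong (odd? (σ S e) xor_) backtrack ⟩
        odd? (σ S e) xor odd? (σ S (edge P k)) ≡⟨ cong (λ e′ → odd? (σ S e) xor odd? (σ S e′)) e≡eₖ ⟨
        odd? (σ S e) xor odd? (σ S e)       ≡⟨ xor-same (odd? (σ S e)) ⟩
        false                               ∎) λ ()
        where
        open ≡-Reasoning
        backtrack : parity P ≡ odd? (σ S (edge P k))
        backtrack = single-edge-parity P k (P-inj (sym y≡)) (P-inj (trans (sym x≡) (sym (vertex-last P))))

      einj : Injective _≡_ _≡_ (edge C)
      einj {zero}  {zero}  _  = refl
      einj {zero}  {suc k} eq = contradiction eq (e∉P k)
      einj {suc i} {zero}  eq = contradiction (sym eq) (e∉P i)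
      einj {suc i} {suc k} eq = cong suc (edge-injective P P-path eq)

    module _ (acyclic : ¬ Cycle S T) where

      -- When the walk returns to x, the closed part is even (an odd one would contain a cycle),
      -- so cutting it out keeps the parity.
      shortcut : ∀ {x y} (W : Walk S T x y) → ∃ λ (P : Walk S T x y) → IsPath P × parity P ≡ parity W
      shortcut (nil x∈T) = nil x∈T , tt , refl
      shortcut {x} (step e e∈T j w) with shortcut w
      ... | P , P-path , P≡w with any? (λ i → vertex P i ≟ᶠ x)
      ...   | no x∉P = step e e∈T j P , ((λ i eq → x∉P (i , eq)) , P-path) , cong (odd? (σ S e) xor_) P≡w
      ...   | yes (i , refl) with odd? (σ S e) xor parity (take P i) in loop
      ...     | true  = ⊥-elim (acyclic (odd-closed-path⇒cycle e∈T j (take P i) (take-isPath P i P-path) loop))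
      ...     | false = drop P i , drop-isPath P i P-path , (begin
        parity (drop P i)                                          ≡⟨ cong (_xor parity (drop P i)) loop ⟨
        (odd? (σ S e) xor parity (take P i)) xor parity (drop P i) ≡⟨ xor-assoc (odd? (σ S e)) _ _ ⟩
        odd? (σ S e) xor (parity (take P i) xor parity (drop P i)) ≡⟨ cong (odd? (σ S e) xor_) (parity-++ (take P i) (drop P i)) ⟨
        odd? (σ S e) xor parity (take P i ++ drop P i)             ≡⟨ cong (λ W → odd? (σ S e) xor parity W) (take++drop P i) ⟩
        odd? (σ S e) xor parity P                                  ≡⟨ cong (odd? (σ S e) xor_) P≡w ⟩
        odd? (σ S e) xor parity w                                  ∎)
        where open ≡-Reasoning

      closed-path-even : ∀ {x} (P : Walk S T x x) → IsPath P → parity P ≡ false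
      closed-path-even (nil _)        _         = refl
      closed-path-even (step _ _ _ w) (x∉w , _) = contradiction (vertex-last w) (x∉w (fromℕ (length w)))

      parity-unique : ∀ {x y} (W W′ : Walk S T x y) → parity W ≡ parity W′
      parity-unique W W′ with shortcut (W ++ reverse W′)
      ... | P , P-path , P≡W = xor≡false⇒≡ (begin
        parity W xor parity W′           ≡⟨ cong (parity W xor_) (parity-reverse W′) ⟨
        parity W xor parity (reverse W′) ≡⟨ parity-++ W (reverse W′) ⟨
        parity (W ++ reverse W′)         ≡⟨ P≡W ⟨
        parity P                         ≡⟨ closed-path-even P P-path ⟩
        false                            ∎)
        where open ≡-Reasoning

  tree-partition : ∀ {T} → IsTree S T → ∃ (ValidPartition S T)
  tree-partition {T} ((x₀ , x₀∈T) , connected , acyclic) = side , valid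
    where
    open Walks T

    colour : ∀ v {b} → U T v ≡ b → Bool
    colour v {true}  v∈T = parity (connected x₀ v x₀∈T v∈T)
    colour v {false} _   = false

    side : Fin n → Bool
    side v = colour v refl

    colour≡parity : ∀ {v b} (v∈?T : U T v ≡ b) (W : Walk S T x₀ v) → colour v v∈?T ≡ parity W
    colour≡parity {v} {true} v∈T W = parity-unique acyclic (connected x₀ v x₀∈T v∈T) W
    colour≡parity {b = false} v∉T W = contradiction (trans (sym (end∈U W)) v∉T) λ ()

    side≡parity : ∀ {v} (W : Walk S T x₀ v) → side v ≡ parity W
    side≡parity = colour≡parity refl

    side-across : ∀ e → F T e ≡ true →
                  side (proj₂ (ends S e)) ≡ side (proj₁ (ends S e)) xor odd? (σ S e)
    side-across e e∈T = begin
      side b                               ≡⟨ side≡parity (W ++ step e e∈T (inj₁ refl) (nil b∈T)) ⟩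
      parity (W ++ step e e∈T (inj₁ refl) (nil b∈T)) ≡⟨ parity-++ W _ ⟩
      parity W xor (odd? (σ S e) xor false) ≡⟨ cong₂ _xor_ (side≡parity W) (sym (xor-identityʳ _)) ⟨
      side a xor odd? (σ S e)              ∎
      where
      open ≡-Reasoning
      a b : Fin n
      a = proj₁ (ends S e)
      b = proj₂ (ends S e)

      b∈T : U T b ≡ true
      b∈T = proj₂ (closed T e e∈T)

      W : Walk S T x₀ a
      W = connected x₀ a x₀∈T (proj₁ (closed T e e∈T))

    valid : ValidPartition S T side
    valid e e∈T = even-inside , odd-across
      where
      open ≡-Reasoning
      a b : Fin n
      a = proj₁ (ends S e)
      b = proj₂ (ends S e)

      even-inside : σ S e ≡ even → side a ≡ side b
      even-inside σ≡even = sym (begin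
        side b                  ≡⟨ side-across e e∈T ⟩
        side a xor odd? (σ S e) ≡⟨ cong (λ s → side a xor odd? s) σ≡even ⟩
        side a xor false        ≡⟨ xor-identityʳ (side a) ⟩
        side a                  ∎)

      odd-across : σ S e ≡ odd → side a ≢ side b
      odd-across σ≡odd a≡b = not-¬ refl (begin
        side a                  ≡⟨ a≡b ⟩
        side b                  ≡⟨ side-across e e∈T ⟩
        side a xor odd? (σ S e) ≡⟨ cong (λ s → side a xor odd? s) σ≡odd ⟩
        side a xor true         ≡⟨ xor-comm (side a) true ⟩
        true xor side a         ≡⟨ true-xor (side a) ⟩
        not (side a)            ∎)

  -- Removing leaves from a tree

  -- The summand of degree, so that degree S T v is sumℕ S (λ e → incidence T e v) by definition.
  incidence : Subgraph S → Fin (m S) → Fin n → ℕ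
  incidence T e v = if F T e
    then (if ⌊ proj₁ (ends S e) ≟ᶠ v ⌋ then 1 else 0) + (if ⌊ proj₂ (ends S e) ≟ᶠ v ⌋ then 1 else 0)
    else 0

  1≤incidence : ∀ {T e x v} → F T e ≡ true → Joins S e x v → 1 ≤ incidence T e v
  1≤incidence {v = v} e∈T (inj₁ ends≡) rewrite e∈T | ends≡ | isYes≗does (v ≟ᶠ v) | dec-true (v ≟ᶠ v) refl =
    ℕP.m≤n+m 1 _
  1≤incidence {v = v} e∈T (inj₂ ends≡) rewrite e∈T | ends≡ | isYes≗does (v ≟ᶠ v) | dec-true (v ≟ᶠ v) refl =
    s≤s z≤n

  leaf-edge-unique : ∀ {T e e′ x x′ v} → degree S T v ≡ 1 → F T e ≡ true → F T e′ ≡ true →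
                     Joins S e x v → Joins S e′ x′ v → e ≡ e′
  leaf-edge-unique {T} {v = v} deg≡1 e∈T e′∈T j j′ =
    sum≡1⇒support-unique (λ e → incidence T e v) (trans (sym (sumℕ≡sum (λ e → incidence T e v))) deg≡1)
      (1≤incidence {T} e∈T j) (1≤incidence {T} e′∈T j′)

  module Pruning (T : Subgraph S) (X : Fin n → Bool) where

    avoids-X : Fin (m S) → Bool
    avoids-X e = not (X (proj₁ (ends S e))) ∧ not (X (proj₂ (ends S e)))

    prune : Subgraph S
    prune = record
      { U = λ v → U T v ∧ not (X v)
      ; F = λ e → F T e ∧ avoids-X e
      ; closed = λ e e∈ →
          let e∈T , avoids = ∧-true⁻ {F T e} e∈
              a∉X , b∉X = ∧-true⁻ {not (X (proj₁ (ends S e)))} avoids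
              a∈T , b∈T = closed T e e∈T
          in ∧-true⁺ a∈T a∉X , ∧-true⁺ b∈T b∉X }

    F-prune⊆F : ∀ e → F prune e ≡ true → F T e ≡ true
    F-prune⊆F e = proj₁ ∘ ∧-true⁻ {F T e}

    prune-edge : ∀ {e x y} → F T e ≡ true → Joins S e x y → X x ≡ false → X y ≡ false → F prune e ≡ true
    prune-edge e∈T (inj₁ refl) x∉X y∉X rewrite e∈T | x∉X | y∉X = refl
    prune-edge e∈T (inj₂ refl) x∉X y∉X rewrite e∈T | x∉X | y∉X = refl

    module _ (X⊆leaves : ∀ v → X v ≡ true → degree S T v ≡ 1) where

      -- A walk can only enter a leaf and leave it again along the same edge, so such detours are cut out.
      avoid : ∀ {x y} → Walk S T x y → X x ≡ false → X y ≡ false → Walk S prune x y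
      avoid (nil x∈T) x∉X _ = nil (∧-true⁺ x∈T (cong not x∉X))
      avoid (step {y = y′} e e∈T j w) x∉X z∉X with X y′ in y′∈?X
      ... | false = step e (prune-edge e∈T j x∉X y′∈?X) j (avoid w y′∈?X z∉X)
      ... | true with w
      ...   | nil _ = contradiction (trans (sym y′∈?X) z∉X) λ ()
      ...   | step e′ e′∈T j′ w′
              with Joins-endpoints j (subst (λ e″ → Joins S e″ _ _)
                     (sym (leaf-edge-unique {T} (X⊆leaves y′ y′∈?X) e∈T e′∈T j (Joins-sym j′))) j′)
      ...     | inj₁ (refl , _) = contradiction (trans (sym y′∈?X) x∉X) λ ()
      ...     | inj₂ (refl , _) = avoid w′ x∉X z∉X

      prune-isTree : IsTree S T → (∃ λ v → U prune v ≡ true) → IsTree S prune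
      prune-isTree (_ , connected , acyclic) nonempty =
        nonempty , prune-connected , acyclic ∘ Cycle-mono F-prune⊆F
        where
        prune-connected : Connected S prune
        prune-connected x y x∈ y∈ =
          let x∈T , x∉X = ∧-true⁻ {U T x} x∈
              y∈T , y∉X = ∧-true⁻ {U T y} y∈
          in avoid (connected x y x∈T y∈T) (not-injective x∉X) (not-injective y∉X)

  -- Alternating sums of pruned trees

  AltAtLeast-weaken : ∀ {w a b c} k → c ≤ k * a → AltAtLeast S w a b → AltAtLeast S w c (b * k)
  AltAtLeast-weaken {w} {a} {b} {c} k c≤ka (T , tree , side , valid , a≤b*alt) =
    T , tree , side , valid , (begin
      c                ≤⟨ c≤ka ⟩
      k * a            ≤⟨ ℕP.*-monoʳ-≤ k a≤b*alt ⟩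
      k * (b * alt)    ≡⟨ ℕP.*-assoc k b alt ⟨
      k * b * alt      ≡⟨ cong (_* alt) (ℕP.*-comm k b) ⟩
      b * k * alt      ∎)
    where
    open ℕP.≤-Reasoning
    alt : ℕ
    alt = altWith S T side w

  module Alternation {T} (tree : IsTree S T) (w : Fin n → ℤ) where
    open Pruning T

    side : Fin n → Bool
    side = proj₁ (tree-partition tree)

    valid : ValidPartition S T side
    valid = proj₂ (tree-partition tree)

    signed : Fin n → ℤ
    signed v = if side v then w v else ℤ.- w v

    pruned-sum : (Fin n → Bool) → ℤ
    pruned-sum X = ℤΣ.sum (λ v → if U T v ∧ not (X v) then signed v else 0ℤ)

    alt-prune : ∀ X → altWith S (prune X) side w ≡ ∣ pruned-sum X ∣
    alt-prune X = cong ∣_∣ (sumℤ≡sum (λ v → if U T v ∧ not (X v) then signed v else 0ℤ))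

    pruned-witness : ∀ X → (∀ v → X v ≡ true → degree S T v ≡ 1) →
                     ∀ {a b} → a ≤ b * ∣ pruned-sum X ∣ → AltAtLeast S w a b
    pruned-witness X X⊆leaves {a} {b} a≤ with any? (λ v → U (prune X) v ≟ᵇ true)
    ... | yes nonempty =
      prune X , prune-isTree X X⊆leaves tree nonempty ,
      side , ValidPartition-mono {T} {prune X} {side} (F-prune⊆F X) valid ,
      subst (λ s → a ≤ b * s) (sym (alt-prune X)) a≤
    -- An empty pruned graph is not a tree, but then its sum is 0 and T itself will do.
    ... | no empty =
      T , tree , side , valid ,
      ℕP.≤-trans a≤ (ℕP.≤-trans (ℕP.≤-reflexive (trans (cong (λ s → b * ∣ s ∣) sum≡0) (ℕP.*-zeroʳ b))) z≤n)
      where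
      sum≡0 : pruned-sum X ≡ 0ℤ
      sum≡0 = trans (ℤΣ.sum-cong-≗ (λ v → cong (if_then signed v else 0ℤ) (¬-not (empty ∘ (v ,_)))))
                    (ℤΣ.sum-replicate-zero n)

    ∣signed∣ : ∀ v → ∣ signed v ∣ ≡ ∣ w v ∣
    ∣signed∣ v with side v
    ... | true  = refl
    ... | false = ℤP.∣-i∣≡∣i∣ (w v)

    module _ {r} (f : Fin r → Fin n) (f-inj : Injective _≡_ _≡_ f) (leaves : ∀ j → IsLeaf S T (f j)) where

      image⊆leaves : ∀ v → image? f v ≡ true → IsLeaf S T v
      image⊆leaves v v∈f with any? (λ j → f j ≟ᶠ v)
      ... | yes (j , refl) = leaves j
      ... | no _           = contradiction v∈f λ ()

      marked-leaf-degree : ∀ v {b} → image? f v ∧ b ≡ true → degree S T v ≡ 1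
      marked-leaf-degree v = proj₂ ∘ image⊆leaves v ∘ proj₁ ∘ ∧-true⁻ {image? f v}

      negative-leaf nonnegative-leaf : Fin n → Bool
      negative-leaf v = image? f v ∧ isNegative (signed v)
      nonnegative-leaf v = image? f v ∧ not (isNegative (signed v))

      leaf-weight : ℕ
      leaf-weight = sum (λ j → ∣ w (f j) ∣)

      pruned-sum-difference : pruned-sum negative-leaf ≡ pruned-sum nonnegative-leaf ℤ.+ + leaf-weight
      pruned-sum-difference = begin
        pruned-sum negative-leaf
          ≡⟨ ℤΣ.sum-cong-≗ (λ v → sign-split (U T v) (image? f v) (signed v) (proj₁ ∘ image⊆leaves v)) ⟩
        ℤΣ.sum (λ v → kept v ℤ.+ + removed v)
          ≡⟨ ℤΣ.∑-distrib-+ kept (λ v → + removed v) ⟩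
        pruned-sum nonnegative-leaf ℤ.+ ℤΣ.sum (λ v → + removed v)
          ≡⟨ cong (λ s → pruned-sum nonnegative-leaf ℤ.+ s) (sum-pos removed) ⟩
        pruned-sum nonnegative-leaf ℤ.+ + sum removed
          ≡⟨ cong (λ s → pruned-sum nonnegative-leaf ℤ.+ + s)
               (trans (sum-image f f-inj (∣_∣ ∘ signed)) (ℕΣ.sum-cong-≗ (∣signed∣ ∘ f))) ⟩
        pruned-sum nonnegative-leaf ℤ.+ + leaf-weight ∎
        where
        open ≡-Reasoning
        kept : Fin n → ℤ
        kept v = if U T v ∧ not (nonnegative-leaf v) then signed v else 0ℤ
        removed : Fin n → ℕ
        removed v = if image? f v then ∣ signed v ∣ else 0

      leaf-weight≤ : leaf-weight ≤ ∣ pruned-sum negative-leaf ∣ + ∣ pruned-sum nonnegative-leaf ∣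
      leaf-weight≤ = begin
        leaf-weight                                           ≡⟨ cong ∣_∣ difference ⟨
        ∣ pruned-sum negative-leaf ℤ.- pruned-sum nonnegative-leaf ∣ ≤⟨ ℤP.∣i-j∣≤∣i∣+∣j∣ (pruned-sum negative-leaf) (pruned-sum nonnegative-leaf) ⟩
        ∣ pruned-sum negative-leaf ∣ + ∣ pruned-sum nonnegative-leaf ∣ ∎
        where
        open ℕP.≤-Reasoning
        difference : pruned-sum negative-leaf ℤ.- pruned-sum nonnegative-leaf ≡ + leaf-weight
        difference = trans (cong (ℤ._- pruned-sum nonnegative-leaf) pruned-sum-difference)
                           (solve 2 (λ s d → (s :+ d) :- s := d) refl (pruned-sum nonnegative-leaf) (+ leaf-weight))

      leaf-weight≤2*alt : AltAtLeast S w leaf-weight 2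
      leaf-weight≤2*alt with m≤n+o⇒m≤2n⊎m≤2o ∣ pruned-sum negative-leaf ∣ ∣ pruned-sum nonnegative-leaf ∣ leaf-weight≤
      ... | inj₁ ≤2neg = pruned-witness negative-leaf (λ v → marked-leaf-degree v) {b = 2} ≤2neg
      ... | inj₂ ≤2nonneg = pruned-witness nonnegative-leaf (λ v → marked-leaf-degree v) {b = 2} ≤2nonneg

lemma1 : ∀ {n} (S : SignedGraph n) (k r : ℕ) (w : Fin k → Fin n → ℤ) →
    1 ≤ k →
    Σ (Subgraph S) (Decorated S (λ v → ∃ λ i → w i v ≢ 0ℤ) r) →
    ∃ λ i → AltAtLeast S (w i) r (2 * k)
lemma1 S zero    r w () _
lemma1 S (suc k) r w _ (T , tree , f , f-inj , decorated) =
  i , AltAtLeast-weaken S {b = 2} (suc k) r≤ (Alternation.leaf-weight≤2*alt S tree (w i) f f-inj (proj₁ ∘ decorated))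
  where
  D : Fin (suc k) → ℕ
  D i = sum (λ j → ∣ w i (f j) ∣)

  i : Fin (suc k)
  i = proj₁ (sum≤size*max D)

  terminal : ∀ j → 1 ≤ sum (λ i → ∣ w i (f j) ∣)
  terminal j = let t , wₜ≢0 = proj₂ (decorated j) in
    ℕP.≤-trans (ℕP.n≢0⇒n>0 (wₜ≢0 ∘ ℤP.∣i∣≡0⇒i≡0)) (term≤sum (λ i → ∣ w i (f j) ∣) t)

  r≤ : r ≤ suc k * D i
  r≤ = begin
    r                                        ≤⟨ size≤sum _ terminal ⟩
    sum (λ j → sum (λ i → ∣ w i (f j) ∣))    ≡⟨ ℕΣ.∑-comm (λ i j → ∣ w i (f j) ∣) ⟨
    sum D                                    ≤⟨ proj₂ (sum≤size*max D) ⟩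
    suc k * D i                              ∎
    where open ℕP.≤-Reasoning
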